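{- For every set of formulas $\Delta$ and every formula $\varphi$ of $\mathrm{PRED2}_0$, the conditions $\Delta\Vdash\varphi$ and $\Delta\vdash_{\mathrm{PRED2}_0}\varphi$ are equivalent.
   Context: $\mathrm{PRED2}_0$: fix a finite set $\mathcal{B}$ of base types; types are $\mathcal{T}::= o\mid \beta\mid \beta\to\tau$ ($\beta\in\mathcal{B}$). For each type $\tau$: a countable set $V_\tau$ of variables (each variable has a unique type) and a countable set $\Sigma_\tau$ of constants. Terms $T_\tau$: variables in $V_\tau$, constants in $\Sigma_\tau$, applications $t\,s$ with $t\in T_{\sigma\to\tau}$, $s\in T_\sigma$, $\sigma\in\mathcal{B}$; formulas ($T_o$) additionally include $\varphi\supset\psi$ and $\forall x.\varphi$ for $x\in V_\tau$, $\tau\in\mathcal{B}\cup\{o\}$. Formulas up to $\alpha$-equivalence; $\varphi[x/t]$ capture-avoiding substitution. Derivability ($\Delta$ finite): axiom $\Delta,\varphi\vdash\varphi$; from $\Delta,\varphi\vdash\psi$ infer $\Delta\vdash\varphi\supset\psi$; from $\Delta\vdash\varphi\supset\psi$ and $\Delta\vdash\varphi$ infer $\Delta\vdash\psi$; from $\Delta\vdash\varphi$ infer $\Delta\vdash\forall x.\varphi$ if $x$ not free in $\Delta$; from $\Delta\vdash\forall x.\varphi$, $x\in V_\tau$, infer $\Delta\vdash\varphi[x/t]$ for $t\in T_\tau$. For arbitrary $\Delta$, $\Delta\vdash\varphi$ means derivable from a finite subset of $\Delta$. A Kripke pre-model is $\mathcal{M}=(\mathcal{S},\le,\{\mathcal{D}_\tau\}_{\tau\in\mathcal{T}},\cdot,I,\varsigma)$: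 a set of states $\mathcal{S}$ with a partial order $\le$; nonempty sets $\mathcal{D}_\tau$; an operation $\cdot$ with $d_1\cdot d_2\in\mathcal{D}_{\tau_2}$ for $d_1\in\mathcal{D}_{\tau_1\to\tau_2}$, $d_2\in\mathcal{D}_{\tau_1}$; $I(c)\in\mathcal{D}_\tau$ for $c\in\Sigma_\tau$; and $\varsigma$ assigning to each element of $\mathcal{D}_o$ an upward-closed subset of $\mathcal{S}$. A valuation $u$ maps each $V_\tau$ into $\mathcal{D}_\tau$; $u[x/d]$ is the updated valuation. For each valuation $u$ the pre-model comes with an interpretation $[\![\cdot]\!]_u$ sending terms of type $\tau$ to $\mathcal{D}_\tau$ with $[\![x]\!]_u=u(x)$, $[\![c]\!]_u=I(c)$, $[\![t_1t_2]\!]_u=[\![t_1]\!]_u\cdot[\![t_2]\!]_u$. Write $s,u\Vdash\varphi$ if $s\in\varsigma([\![\varphi]\!]_u)$, and $s,u\Vdash\Delta$ if this holds for all $\varphi\in\Delta$. A Kripke model is a pre-model such that for all $s,u$: $s,u\Vdash\varphi\supset\psi$ iff every $s'\ge s$ with $s',u\Vdash\varphi$ has $s',u\Vdash\psi$; $s,u\Vdash\forall x.\varphi$ ($x\in V_\tau$) iff $s',u[x/d]\Vdash\varphi$ for all $s'\ge s$ and $d\in\mathcal{D}_\tau$; and $s,u\not\Vdash\forall p.p$ for $p\in V_o$. $\Delta\Vdash\varphi$ means: for every Kripke model, state $s$ and valuation $u$, $s,u\Vdash\Delta$ implies $s,u\Vdash\varphi$. -}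

module Defs where

open import Level using (Level; _⊔_) renaming (suc to lsuc; zero to lzero)
open import Data.Nat as ℕ using (ℕ)
open import Data.Fin as Fin using (Fin)
open import Data.List using (List; []; _∷_; _++_)
open import Data.List.Relation.Unary.All using (All)
open import Data.List.Relation.Unary.Any using (Any)
open import Data.List.Membership.Propositional using (_∈_)
open import Data.Product using (Σ; _×_; _,_)
open import Data.Sum using (_⊎_; inj₁; inj₂)
open import Relation.Binary.PropositionalEquality using (_≡_; refl; cong; cong₂)
open import Relation.Binary.Structures using (IsPartialOrder)
open import Relation.Nullary using (¬_; Dec; yes; no)
open import Function.Bundles using (_⇔_)

data Ty (nB : ℕ) : Set where
  o    : Ty nB
  base : Fin nB → Ty nB
  _⇒_  : Fin nB → Ty nB → Ty nB

infixr 5 _⇒_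

_≟Ty_ : ∀ {nB} (σ τ : Ty nB) → Dec (σ ≡ τ)
o ≟Ty o = yes refl
o ≟Ty base _ = no (λ ())
o ≟Ty (_ ⇒ _) = no (λ ())
base _ ≟Ty o = no (λ ())
base β ≟Ty base γ with β Fin.≟ γ
... | yes refl = yes refl
... | no ne = no (λ { refl → ne refl })
base _ ≟Ty (_ ⇒ _) = no (λ ())
(_ ⇒ _) ≟Ty o = no (λ ())
(_ ⇒ _) ≟Ty base _ = no (λ ())
(β ⇒ σ) ≟Ty (γ ⇒ τ) with β Fin.≟ γ | σ ≟Ty τ
... | yes refl | yes refl = yes refl
... | no ne | _ = no (λ { refl → ne refl })
... | _ | no ne = no (λ { refl → ne refl })

data QTy (nB : ℕ) : Set where
  qo    : QTy nB
  qbase : Fin nB → QTy nB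

⌜_⌝ : ∀ {nB} → QTy nB → Ty nB
⌜ qo ⌝ = o
⌜ qbase β ⌝ = base β

-- Variables of type τ are x^τ_i with i : ℕ (countably many per type).
-- Terms are represented in locally nameless style: bound variables are
-- (typed, scoped) de Bruijn indices, free variables are named.  Hence
-- terms with empty bound-variable context are exactly terms up to
-- α-equivalence.

module PRED2 (nB : ℕ) (Con : Ty nB → Set) where

  Ctx : Set
  Ctx = List (QTy nB)

  data _∋_ : Ctx → QTy nB → Set where
    here  : ∀ {Γ q} → (q ∷ Γ) ∋ q
    there : ∀ {Γ p q} → Γ ∋ q → (p ∷ Γ) ∋ q

  data Tm (Γ : Ctx) : Ty nB → Set where
    fvar : ∀ {τ} → ℕ → Tm Γ τ
    bvar : ∀ {q} → Γ ∋ q → Tm Γ ⌜ q ⌝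
    con  : ∀ {τ} → Con τ → Tm Γ τ
    app  : ∀ {β τ} → Tm Γ (β ⇒ τ) → Tm Γ (base β) → Tm Γ τ
    imp  : Tm Γ o → Tm Γ o → Tm Γ o
    all  : (q : QTy nB) → Tm (q ∷ Γ) o → Tm Γ o

  Term : Ty nB → Set
  Term = Tm []

  Formula : Set
  Formula = Term o

  injˡ : ∀ {Γ p} Δ → Γ ∋ p → (Γ ++ Δ) ∋ p
  injˡ Δ here = here
  injˡ Δ (there x) = there (injˡ Δ x)

  lastIn : ∀ Γ {q} → (Γ ++ q ∷ []) ∋ q
  lastIn [] = here
  lastIn (_ ∷ Γ) = there (lastIn Γ)

  split : ∀ Γ {q p} → (Γ ++ q ∷ []) ∋ p → (Γ ∋ p) ⊎ (p ≡ q)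
  split [] here = inj₂ refl
  split [] (there ())
  split (_ ∷ Γ) here = inj₁ here
  split (_ ∷ Γ) (there x) with split Γ x
  ... | inj₁ y = inj₁ (there y)
  ... | inj₂ e = inj₂ e

  wk : ∀ {Γ τ} Δ → Tm Δ τ → Tm (Δ ++ Γ) τ
  wk Δ (fvar i) = fvar i
  wk {Γ} Δ (bvar x) = bvar (injˡ Γ x)
  wk Δ (con c) = con c
  wk Δ (app t s) = app (wk Δ t) (wk Δ s)
  wk Δ (imp φ ψ) = imp (wk Δ φ) (wk Δ ψ)
  wk Δ (all q φ) = all q (wk (q ∷ Δ) φ)

  -- instantiate the outermost bound variable by a term
  inst′ : ∀ Γ {q τ} → Tm (Γ ++ q ∷ []) τ → Term ⌜ q ⌝ → Tm Γ τ
  inst′ Γ (fvar i) t = fvar i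
  inst′ Γ (bvar x) t with split Γ x
  ... | inj₁ y = bvar y
  ... | inj₂ refl = wk [] t
  inst′ Γ (con c) t = con c
  inst′ Γ (app u v) t = app (inst′ Γ u t) (inst′ Γ v t)
  inst′ Γ (imp φ ψ) t = imp (inst′ Γ φ t) (inst′ Γ ψ t)
  inst′ Γ (all p φ) t = all p (inst′ (p ∷ Γ) φ t)

  -- abstract the free variable x^⌜q⌝_i as the outermost bound variable
  close′ : ∀ Γ (q : QTy nB) → ℕ → ∀ {τ} → Tm Γ τ → Tm (Γ ++ q ∷ []) τ
  close′ Γ q i (fvar {τ} j) with τ ≟Ty ⌜ q ⌝ | j ℕ.≟ i
  ... | yes refl | yes _ = bvar (lastIn Γ)
  ... | _ | _ = fvar j
  close′ Γ q i (bvar x) = bvar (injˡ (q ∷ []) x)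
  close′ Γ q i (con c) = con c
  close′ Γ q i (app t s) = app (close′ Γ q i t) (close′ Γ q i s)
  close′ Γ q i (imp φ ψ) = imp (close′ Γ q i φ) (close′ Γ q i ψ)
  close′ Γ q i (all p φ) = all p (close′ (p ∷ Γ) q i φ)

  ∀[_,_]_ : (q : QTy nB) → ℕ → Formula → Formula
  ∀[ q , i ] φ = all q (close′ [] q i φ)

  -- φ[x/t], where ∀x.φ is given as  all q body
  inst : ∀ {q} → Tm (q ∷ []) o → Term ⌜ q ⌝ → Formula
  inst body t = inst′ [] body t

  data FreeIn (τ : Ty nB) (i : ℕ) : ∀ {Γ σ} → Tm Γ σ → Set where
    var  : ∀ {Γ} → FreeIn τ i (fvar {Γ} {τ} i)
    appˡ : ∀ {Γ β σ} {t : Tm Γ (β ⇒ σ)} {s} → FreeIn τ i t → FreeIn τ i (app t s)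
    appʳ : ∀ {Γ β σ} {t : Tm Γ (β ⇒ σ)} {s} → FreeIn τ i s → FreeIn τ i (app t s)
    impˡ : ∀ {Γ} {φ ψ : Tm Γ o} → FreeIn τ i φ → FreeIn τ i (imp φ ψ)
    impʳ : ∀ {Γ} {φ ψ : Tm Γ o} → FreeIn τ i ψ → FreeIn τ i (imp φ ψ)
    all  : ∀ {Γ q} {φ : Tm (q ∷ Γ) o} → FreeIn τ i φ → FreeIn τ i (all q φ)

  infix 3 _⊢₀_
  data _⊢₀_ (Δ : List Formula) : Formula → Set where
    ax   : ∀ {φ} → φ ∈ Δ → Δ ⊢₀ φ
    ⊃I   : ∀ {φ ψ} → (φ ∷ Δ) ⊢₀ ψ → Δ ⊢₀ imp φ ψ
    ⊃E   : ∀ {φ ψ} → Δ ⊢₀ imp φ ψ → Δ ⊢₀ φ → Δ ⊢₀ ψ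
    ∀I   : ∀ {φ} (q : QTy nB) (i : ℕ) → ¬ Any (FreeIn ⌜ q ⌝ i) Δ →
           Δ ⊢₀ φ → Δ ⊢₀ ∀[ q , i ] φ
    ∀E   : ∀ {q} {body : Tm (q ∷ []) o} → Δ ⊢₀ all q body →
           (t : Term ⌜ q ⌝) → Δ ⊢₀ inst body t

  infix 3 _⊢_
  _⊢_ : (Formula → Set) → Formula → Set
  Δ ⊢ φ = Σ (List Formula) λ Γ → All Δ Γ × (Γ ⊢₀ φ)

  Valuation : ∀ {ℓ} → (Ty nB → Set ℓ) → Set ℓ
  Valuation D = ∀ τ → ℕ → D τ

  update : ∀ {ℓ} (D : Ty nB → Set ℓ) → Valuation D → (τ : Ty nB) → ℕ → D τ → Valuation D
  update D u τ i d σ j with σ ≟Ty τ | j ℕ.≟ i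
  ... | yes refl | yes _ = d
  ... | _ | _ = u σ j

  record PreModel (ℓ : Level) : Set (lsuc ℓ) where
    infixl 7 _·_
    field
      S      : Set ℓ
      _≤_    : S → S → Set ℓ
      ≤-po   : IsPartialOrder _≡_ _≤_
      D      : Ty nB → Set ℓ
      D-ne   : ∀ τ → D τ
      _·_    : ∀ {β τ} → D (β ⇒ τ) → D (base β) → D τ
      I      : ∀ {τ} → Con τ → D τ
      ς      : D o → S → Set ℓ
      ς-up   : ∀ d {s s′} → s ≤ s′ → ς d s → ς d s′

      ⟦_⟧    : ∀ {τ} → Term τ → Valuation D → D τ
      ⟦var⟧  : ∀ {τ} i (u : Valuation D) → ⟦ fvar {[]} {τ} i ⟧ u ≡ u τ i
      ⟦con⟧  : ∀ {τ} (c : Con τ) u → ⟦ con {[]} c ⟧ u ≡ I c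
      ⟦app⟧  : ∀ {β τ} (t : Term (β ⇒ τ)) (s : Term (base β)) u →
               ⟦ app t s ⟧ u ≡ ⟦ t ⟧ u · ⟦ s ⟧ u

    Val : Set ℓ
    Val = Valuation D

    _[_,_↦_] : Val → (τ : Ty nB) → ℕ → D τ → Val
    _[_,_↦_] = update D

    infix 4 _,_⊩_
    _,_⊩_ : S → Val → Formula → Set ℓ
    s , u ⊩ φ = ς (⟦ φ ⟧ u) s

  record IsKripke {ℓ} (M : PreModel ℓ) : Set (lsuc ℓ) where
    open PreModel M
    field
      ⊩imp : ∀ s u φ ψ →
             (s , u ⊩ imp φ ψ) ⇔ (∀ s′ → s ≤ s′ → s′ , u ⊩ φ → s′ , u ⊩ ψ)
      ⊩all : ∀ s u (q : QTy nB) (i : ℕ) φ →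
             (s , u ⊩ ∀[ q , i ] φ) ⇔
             (∀ s′ → s ≤ s′ → (d : D ⌜ q ⌝) → s′ , u [ ⌜ q ⌝ , i ↦ d ] ⊩ φ)
      ⊩⊥   : ∀ s u (p : ℕ) → ¬ (s , u ⊩ ∀[ qo , p ] fvar p)

  infix 3 _⊩⟨_⟩_
  _⊩⟨_⟩_ : (Formula → Set) → (ℓ : Level) → Formula → Set (lsuc ℓ)
  Δ ⊩⟨ ℓ ⟩ φ = (M : PreModel ℓ) → IsKripke M →
               let open PreModel M in
               ∀ s u → (∀ ψ → Δ ψ → s , u ⊩ ψ) → s , u ⊩ φ

module Submission where

-- Renaming, weakening, closing a free variable (∀[ q , i ]) and
-- instantiating a bound one (inst) are all instances of one simultaneous
-- substitution `sub`, so their interactions (close-inst, subFree-inst,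
-- inst-subFree-close, close-subFree-close) follow from the fusion law sub-sub.
-- Derivability is closed under substitution of free variables (⊢₀-subst,
-- renaming eigenvariables apart), and weakening is a special case.
--
-- A pre-model interprets formulas abstractly, constrained only by
-- the Kripke clauses.  The substitution lemma eval-subFree (by induction on
-- size, opening quantifiers with fresh variables) gives the coincidence lemma,
-- and with both every rule is valid (sound₀).
--
-- The hypotheses are moved to even variables.  The canonical
-- model has as states the finite lists of formulas consistent with them,
-- ordered by extension, closed terms as values, and derivability as forcing.
-- Excluded middle decides consistency in the ⊃ clause; the ∀ clause uses an odd,
-- hence fresh, eigenvariable.  Evaluating Δ ⊩ φ at the empty state gives Δ ⊢ φ.

open import Defs
open import Level using (Level)
open import Data.Nat using (ℕ)
open import Function.Bundles using (_↣_; _⇔_)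
open import Axiom.ExcludedMiddle using (ExcludedMiddle)

open import Level using (Lift; lift; lower) renaming (zero to lzero)
open import Data.Nat as ℕ using (zero; suc; _+_; _*_; _⊔_; _≤_; _<_; s≤s; ⌊_/2⌋)
open import Data.Nat.Properties
  using (≤-refl; ≤-trans; <-≤-trans; <⇒≱; m≤m⊔n; m≤n⊔m; m≤m+n; m≤n+m; n≤1+n; +-identityʳ;
         n≡⌊n+n/2⌋; even≢odd)
open import Data.List using (List; []; _∷_; _++_; map)
open import Data.List.Properties using (++-assoc; ++-identityˡ-unique; ++-conicalʳ)
open import Data.List.Relation.Unary.All as All using (All; []; _∷_)
import Data.List.Relation.Unary.All.Properties as AllP
open import Data.List.Relation.Unary.Any as Any using (Any)
import Data.List.Relation.Unary.Any.Properties as AnyP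
open import Data.List.Membership.Propositional using (_∈_; lose)
open import Data.List.Membership.Propositional.Properties using (∈-map⁺)
open import Data.List.Relation.Binary.Subset.Propositional using (_⊆_)
import Data.List.Relation.Binary.Subset.Propositional.Properties as Subset
open import Data.Product using (Σ; _×_; _,_)
open import Data.Sum using (_⊎_; inj₁; inj₂)
open import Data.Empty using (⊥-elim; ⊥-elim-irr)
open import Relation.Binary.PropositionalEquality
  using (_≡_; _≢_; refl; sym; trans; cong; cong₂; subst; isEquivalence; module ≡-Reasoning)
open import Relation.Binary.Structures using (IsPartialOrder)
open import Relation.Nullary using (¬_; yes; no)
open import Relation.Nullary.Decidable using (_×-dec_)
open import Function.Bundles using (mk⇔; Equivalence)
open import Function.Properties.Equivalence using () renaming (refl to ⇔-refl; trans to ⇔-trans)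

open Equivalence using (to; from)

module Syntax (nB : ℕ) (Con : Ty nB → Set) where
  open PRED2 nB Con
  open ≡-Reasoning

  Ren : Ctx → Ctx → Set
  Ren Γ Γ′ = ∀ {q} → Γ ∋ q → Γ′ ∋ q

  liftRen : ∀ {Γ Γ′ p} → Ren Γ Γ′ → Ren (p ∷ Γ) (p ∷ Γ′)
  liftRen ρ here      = here
  liftRen ρ (there x) = there (ρ x)

  ren : ∀ {Γ Γ′ τ} → Ren Γ Γ′ → Tm Γ τ → Tm Γ′ τ
  ren ρ (fvar i)  = fvar i
  ren ρ (bvar x)  = bvar (ρ x)
  ren ρ (con c)   = con c
  ren ρ (app t s) = app (ren ρ t) (ren ρ s)
  ren ρ (imp φ ψ) = imp (ren ρ φ) (ren ρ ψ)
  ren ρ (all q φ) = all q (ren (liftRen ρ) φ)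

  ren-ext : ∀ {Γ Γ′ τ} {ρ ρ′ : Ren Γ Γ′} → (∀ {q} (x : Γ ∋ q) → ρ x ≡ ρ′ x) →
            (t : Tm Γ τ) → ren ρ t ≡ ren ρ′ t
  ren-ext h (fvar i)  = refl
  ren-ext h (bvar x)  = cong bvar (h x)
  ren-ext h (con c)   = refl
  ren-ext h (app t s) = cong₂ app (ren-ext h t) (ren-ext h s)
  ren-ext h (imp φ ψ) = cong₂ imp (ren-ext h φ) (ren-ext h ψ)
  ren-ext h (all q φ) = cong (all q) (ren-ext (λ { here → refl ; (there x) → cong there (h x) }) φ)

  ren-ren : ∀ {Γ₁ Γ₂ Γ₃ τ} (ρ₂ : Ren Γ₂ Γ₃) (ρ₁ : Ren Γ₁ Γ₂) (t : Tm Γ₁ τ) →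
            ren ρ₂ (ren ρ₁ t) ≡ ren (λ x → ρ₂ (ρ₁ x)) t
  ren-ren ρ₂ ρ₁ (fvar i)  = refl
  ren-ren ρ₂ ρ₁ (bvar x)  = refl
  ren-ren ρ₂ ρ₁ (con c)   = refl
  ren-ren ρ₂ ρ₁ (app t s) = cong₂ app (ren-ren ρ₂ ρ₁ t) (ren-ren ρ₂ ρ₁ s)
  ren-ren ρ₂ ρ₁ (imp φ ψ) = cong₂ imp (ren-ren ρ₂ ρ₁ φ) (ren-ren ρ₂ ρ₁ ψ)
  ren-ren ρ₂ ρ₁ (all q φ) = cong (all q) (trans (ren-ren (liftRen ρ₂) (liftRen ρ₁) φ)
    (ren-ext (λ { here → refl ; (there x) → refl }) φ))

  ren-id : ∀ {Γ τ} (ρ : Ren Γ Γ) → (∀ {q} (x : Γ ∋ q) → ρ x ≡ x) → (t : Tm Γ τ) → ren ρ t ≡ t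
  ren-id ρ h (fvar i)  = refl
  ren-id ρ h (bvar x)  = cong bvar (h x)
  ren-id ρ h (con c)   = refl
  ren-id ρ h (app t s) = cong₂ app (ren-id ρ h t) (ren-id ρ h s)
  ren-id ρ h (imp φ ψ) = cong₂ imp (ren-id ρ h φ) (ren-id ρ h ψ)
  ren-id ρ h (all q φ) =
    cong (all q) (ren-id (liftRen ρ) (λ { here → refl ; (there x) → cong there (h x) }) φ)

  emptyRen : ∀ {Γ} → Ren [] Γ
  emptyRen ()

  ren-closed : ∀ {τ} (t : Term τ) → ren emptyRen t ≡ t
  ren-closed = ren-id emptyRen (λ ())

  ren-embedded : ∀ {Γ Γ′ τ} (ρ : Ren Γ Γ′) (t : Term τ) → ren ρ (ren emptyRen t) ≡ ren emptyRen t
  ren-embedded ρ t = trans (ren-ren _ _ t) (ren-ext (λ ()) t)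

  record Sub (Γ Γ′ : Ctx) : Set where
    field
      onBound : ∀ {q} → Γ ∋ q → Tm Γ′ ⌜ q ⌝
      onFree  : ∀ τ → ℕ → Tm Γ′ τ
  open Sub public

  liftSub : ∀ {Γ Γ′ p} → Sub Γ Γ′ → Sub (p ∷ Γ) (p ∷ Γ′)
  onBound (liftSub e) here      = bvar here
  onBound (liftSub e) (there x) = ren there (onBound e x)
  onFree  (liftSub e) τ k       = ren there (onFree e τ k)

  sub : ∀ {Γ Γ′ τ} → Sub Γ Γ′ → Tm Γ τ → Tm Γ′ τ
  sub e (fvar {τ} i) = onFree e τ i
  sub e (bvar x)     = onBound e x
  sub e (con c)      = con c
  sub e (app t s)    = app (sub e t) (sub e s)
  sub e (imp φ ψ)    = imp (sub e φ) (sub e ψ)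
  sub e (all q φ)    = all q (sub (liftSub e) φ)

  sub-ext : ∀ {Γ Γ′ τ} (e e′ : Sub Γ Γ′) → (∀ {q} (x : Γ ∋ q) → onBound e x ≡ onBound e′ x) →
            (t : Tm Γ τ) → (∀ σ k → FreeIn σ k t → onFree e σ k ≡ onFree e′ σ k) →
            sub e t ≡ sub e′ t
  sub-ext e e′ hb (fvar i)  hf = hf _ i var
  sub-ext e e′ hb (bvar x)  hf = hb x
  sub-ext e e′ hb (con c)   hf = refl
  sub-ext e e′ hb (app t s) hf = cong₂ app (sub-ext e e′ hb t (λ σ k f → hf σ k (appˡ f)))
                                           (sub-ext e e′ hb s (λ σ k f → hf σ k (appʳ f)))
  sub-ext e e′ hb (imp φ ψ) hf = cong₂ imp (sub-ext e e′ hb φ (λ σ k f → hf σ k (impˡ f)))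
                                           (sub-ext e e′ hb ψ (λ σ k f → hf σ k (impʳ f)))
  sub-ext e e′ hb (all q φ) hf = cong (all q) (sub-ext (liftSub e) (liftSub e′)
    (λ { here → refl ; (there x) → cong (ren there) (hb x) }) φ
    (λ σ k f → cong (ren there) (hf σ k (all f))))

  sub-ext′ : ∀ {Γ Γ′ τ} (e e′ : Sub Γ Γ′) → (∀ {q} (x : Γ ∋ q) → onBound e x ≡ onBound e′ x) →
             (∀ σ k → onFree e σ k ≡ onFree e′ σ k) → (t : Tm Γ τ) → sub e t ≡ sub e′ t
  sub-ext′ e e′ hb hf t = sub-ext e e′ hb t (λ σ k _ → hf σ k)

  idSub : ∀ {Γ} → Sub Γ Γ
  onBound idSub x   = bvar x
  onFree  idSub τ k = fvar k

  sub-id : ∀ {Γ τ} (e : Sub Γ Γ) → (∀ {q} (x : Γ ∋ q) → onBound e x ≡ bvar x) →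
           (∀ σ k → onFree e σ k ≡ fvar k) → (t : Tm Γ τ) → sub e t ≡ t
  sub-id e hb hf (fvar i)  = hf _ i
  sub-id e hb hf (bvar x)  = hb x
  sub-id e hb hf (con c)   = refl
  sub-id e hb hf (app t s) = cong₂ app (sub-id e hb hf t) (sub-id e hb hf s)
  sub-id e hb hf (imp φ ψ) = cong₂ imp (sub-id e hb hf φ) (sub-id e hb hf ψ)
  sub-id e hb hf (all q φ) = cong (all q) (sub-id (liftSub e)
    (λ { here → refl ; (there x) → cong (ren there) (hb x) })
    (λ σ k → cong (ren there) (hf σ k)) φ)

  _∘ʳ_ : ∀ {Γ₁ Γ₂ Γ₃} → Sub Γ₂ Γ₃ → Ren Γ₁ Γ₂ → Sub Γ₁ Γ₃
  onBound (e ∘ʳ ρ) x = onBound e (ρ x)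
  onFree  (e ∘ʳ ρ)   = onFree e

  _ʳ∘_ : ∀ {Γ₁ Γ₂ Γ₃} → Ren Γ₂ Γ₃ → Sub Γ₁ Γ₂ → Sub Γ₁ Γ₃
  onBound (ρ ʳ∘ e) x   = ren ρ (onBound e x)
  onFree  (ρ ʳ∘ e) τ k = ren ρ (onFree e τ k)

  _∘ₛ_ : ∀ {Γ₁ Γ₂ Γ₃} → Sub Γ₂ Γ₃ → Sub Γ₁ Γ₂ → Sub Γ₁ Γ₃
  onBound (e₂ ∘ₛ e₁) x   = sub e₂ (onBound e₁ x)
  onFree  (e₂ ∘ₛ e₁) τ k = sub e₂ (onFree e₁ τ k)

  sub-ren : ∀ {Γ₁ Γ₂ Γ₃ τ} (e : Sub Γ₂ Γ₃) (ρ : Ren Γ₁ Γ₂) (t : Tm Γ₁ τ) →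
            sub e (ren ρ t) ≡ sub (e ∘ʳ ρ) t
  sub-ren e ρ (fvar i)  = refl
  sub-ren e ρ (bvar x)  = refl
  sub-ren e ρ (con c)   = refl
  sub-ren e ρ (app t s) = cong₂ app (sub-ren e ρ t) (sub-ren e ρ s)
  sub-ren e ρ (imp φ ψ) = cong₂ imp (sub-ren e ρ φ) (sub-ren e ρ ψ)
  sub-ren e ρ (all q φ) = cong (all q) (trans (sub-ren (liftSub e) (liftRen ρ) φ)
    (sub-ext′ _ _ (λ { here → refl ; (there x) → refl }) (λ _ _ → refl) φ))

  ren-sub : ∀ {Γ₁ Γ₂ Γ₃ τ} (ρ : Ren Γ₂ Γ₃) (e : Sub Γ₁ Γ₂) (t : Tm Γ₁ τ) →
            ren ρ (sub e t) ≡ sub (ρ ʳ∘ e) t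
  ren-sub ρ e (fvar i)  = refl
  ren-sub ρ e (bvar x)  = refl
  ren-sub ρ e (con c)   = refl
  ren-sub ρ e (app t s) = cong₂ app (ren-sub ρ e t) (ren-sub ρ e s)
  ren-sub ρ e (imp φ ψ) = cong₂ imp (ren-sub ρ e φ) (ren-sub ρ e ψ)
  ren-sub ρ e (all q φ) = cong (all q) (trans (ren-sub (liftRen ρ) (liftSub e) φ)
    (sub-ext′ _ _ (λ { here → refl ; (there x) → lift-swap (onBound e x) }) (λ σ k → lift-swap (onFree e σ k)) φ))
    where
    lift-swap : ∀ {σ} (t : Tm _ σ) → ren (liftRen ρ) (ren (there {p = q}) t) ≡ ren there (ren ρ t)
    lift-swap t = trans (ren-ren _ _ t) (sym (ren-ren _ _ t))

  sub-lift-there : ∀ {Γ₁ Γ₂ p τ} (e : Sub Γ₁ Γ₂) (t : Tm Γ₁ τ) →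
                   sub (liftSub {p = p} e) (ren there t) ≡ ren there (sub e t)
  sub-lift-there e t = trans (sub-ren (liftSub e) there t)
    (trans (sub-ext′ _ _ (λ x → refl) (λ _ _ → refl) t) (sym (ren-sub there e t)))

  sub-sub : ∀ {Γ₁ Γ₂ Γ₃ τ} (e₂ : Sub Γ₂ Γ₃) (e₁ : Sub Γ₁ Γ₂) (t : Tm Γ₁ τ) →
            sub e₂ (sub e₁ t) ≡ sub (e₂ ∘ₛ e₁) t
  sub-sub e₂ e₁ (fvar i)  = refl
  sub-sub e₂ e₁ (bvar x)  = refl
  sub-sub e₂ e₁ (con c)   = refl
  sub-sub e₂ e₁ (app t s) = cong₂ app (sub-sub e₂ e₁ t) (sub-sub e₂ e₁ s)
  sub-sub e₂ e₁ (imp φ ψ) = cong₂ imp (sub-sub e₂ e₁ φ) (sub-sub e₂ e₁ ψ)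
  sub-sub e₂ e₁ (all q φ) = cong (all q) (trans (sub-sub (liftSub e₂) (liftSub e₁) φ)
    (sub-ext′ _ _ (λ { here → refl ; (there x) → sub-lift-there e₂ (onBound e₁ x) })
                  (λ σ k → sub-lift-there e₂ (onFree e₁ σ k)) φ))

  sub-closed : ∀ {Γ τ} (e : Sub Γ []) → (∀ σ k → onFree e σ k ≡ fvar k) → (t : Term τ) →
               sub e (ren emptyRen t) ≡ t
  sub-closed e h t = trans (sub-ren e emptyRen t) (sub-id (e ∘ʳ emptyRen) (λ ()) h t)

  -- Substitutions of closed terms for free variables (the semantic valuations
  -- of the canonical model, and the renamings of eigenvariables).
  FreeSub : Set
  FreeSub = ∀ τ → ℕ → Term τ

  subFree : ∀ {Γ τ} → FreeSub → Tm Γ τ → Tm Γ τ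
  subFree σ (fvar {τ} i) = ren emptyRen (σ τ i)
  subFree σ (bvar x)     = bvar x
  subFree σ (con c)      = con c
  subFree σ (app t s)    = app (subFree σ t) (subFree σ s)
  subFree σ (imp φ ψ)    = imp (subFree σ φ) (subFree σ ψ)
  subFree σ (all q φ)    = all q (subFree σ φ)

  freeSub : ∀ {Γ} → FreeSub → Sub Γ Γ
  onBound (freeSub σ) x   = bvar x
  onFree  (freeSub σ) τ k = ren emptyRen (σ τ k)

  subFree≡sub : ∀ {Γ τ} (σ : FreeSub) (t : Tm Γ τ) → subFree σ t ≡ sub (freeSub σ) t
  subFree≡sub σ (fvar i)  = refl
  subFree≡sub σ (bvar x)  = refl
  subFree≡sub σ (con c)   = refl
  subFree≡sub σ (app t s) = cong₂ app (subFree≡sub σ t) (subFree≡sub σ s)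
  subFree≡sub σ (imp φ ψ) = cong₂ imp (subFree≡sub σ φ) (subFree≡sub σ ψ)
  subFree≡sub σ (all q φ) = cong (all q) (trans (subFree≡sub σ φ)
    (sub-ext′ _ _ (λ { here → refl ; (there x) → refl }) (λ τ k → sym (ren-embedded there (σ τ k))) φ))

  varSub : FreeSub
  varSub τ k = fvar k

  subFree-id : ∀ {Γ τ} (t : Tm Γ τ) → subFree varSub t ≡ t
  subFree-id (fvar i)  = refl
  subFree-id (bvar x)  = refl
  subFree-id (con c)   = refl
  subFree-id (app t s) = cong₂ app (subFree-id t) (subFree-id s)
  subFree-id (imp φ ψ) = cong₂ imp (subFree-id φ) (subFree-id ψ)
  subFree-id (all q φ) = cong (all q) (subFree-id φ)

  subFree-ext : ∀ {Γ τ} (σ σ′ : FreeSub) (t : Tm Γ τ) → (∀ τ k → FreeIn τ k t → σ τ k ≡ σ′ τ k) →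
                subFree σ t ≡ subFree σ′ t
  subFree-ext σ σ′ t h = trans (subFree≡sub σ t)
    (trans (sub-ext _ _ (λ x → refl) t (λ τ k f → cong (ren emptyRen) (h τ k f))) (sym (subFree≡sub σ′ t)))

  subFree-subFree : ∀ {Γ τ} (θ σ : FreeSub) (t : Tm Γ τ) →
                    subFree θ (subFree σ t) ≡ subFree (λ τ k → subFree θ (σ τ k)) t
  subFree-subFree θ σ t = begin
      subFree θ (subFree σ t)                       ≡⟨ subFree≡sub θ (subFree σ t) ⟩
      sub (freeSub θ) (subFree σ t)                 ≡⟨ cong (sub (freeSub θ)) (subFree≡sub σ t) ⟩
      sub (freeSub θ) (sub (freeSub σ) t)           ≡⟨ sub-sub _ _ t ⟩
      sub (freeSub θ ∘ₛ freeSub σ) t                ≡⟨ sub-ext′ _ _ (λ x → refl) closed t ⟩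
      sub (freeSub (λ τ k → subFree θ (σ τ k))) t   ≡⟨ sym (subFree≡sub _ t) ⟩
      subFree (λ τ k → subFree θ (σ τ k)) t         ∎
    where
    closed : ∀ τ k → sub (freeSub θ) (ren emptyRen (σ τ k)) ≡ ren emptyRen (subFree θ (σ τ k))
    closed τ k = begin
      sub (freeSub θ) (ren emptyRen (σ τ k))        ≡⟨ sub-ren (freeSub θ) emptyRen (σ τ k) ⟩
      sub (freeSub θ ∘ʳ emptyRen) (σ τ k)
        ≡⟨ sub-ext′ _ _ (λ ()) (λ τ′ m → sym (ren-embedded emptyRen (θ τ′ m))) (σ τ k) ⟩
      sub (emptyRen ʳ∘ freeSub θ) (σ τ k)           ≡⟨ sym (ren-sub emptyRen (freeSub θ) (σ τ k)) ⟩
      ren emptyRen (sub (freeSub θ) (σ τ k))        ≡⟨ cong (ren emptyRen) (sym (subFree≡sub θ (σ τ k))) ⟩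
      ren emptyRen (subFree θ (σ τ k))              ∎

  wk≡ren : ∀ {Γ τ} Δ (t : Tm Δ τ) → wk {Γ} Δ t ≡ ren (injˡ Γ) t
  wk≡ren Δ (fvar i)  = refl
  wk≡ren Δ (bvar x)  = refl
  wk≡ren Δ (con c)   = refl
  wk≡ren Δ (app t s) = cong₂ app (wk≡ren Δ t) (wk≡ren Δ s)
  wk≡ren Δ (imp φ ψ) = cong₂ imp (wk≡ren Δ φ) (wk≡ren Δ ψ)
  wk≡ren Δ (all q φ) =
    cong (all q) (trans (wk≡ren (q ∷ Δ) φ) (ren-ext (λ { here → refl ; (there x) → refl }) φ))

  wk-closed : ∀ {Γ τ} (t : Term τ) → wk {Γ} [] t ≡ ren emptyRen t
  wk-closed t = trans (wk≡ren [] t) (ren-ext (λ ()) t)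

  wk-closed-id : ∀ {τ} (t : Term τ) → wk {[]} [] t ≡ t
  wk-closed-id t = trans (wk-closed t) (ren-closed t)

  closeVar : ∀ Γ q → ℕ → ∀ τ → ℕ → Tm (Γ ++ q ∷ []) τ
  closeVar Γ q i τ j with τ ≟Ty ⌜ q ⌝ | j ℕ.≟ i
  ... | yes refl | yes _ = bvar (lastIn Γ)
  ... | _        | _     = fvar j

  closeSub : ∀ Γ q → ℕ → Sub Γ (Γ ++ q ∷ [])
  onBound (closeSub Γ q i) x = bvar (injˡ (q ∷ []) x)
  onFree  (closeSub Γ q i)   = closeVar Γ q i

  closeVar-lift : ∀ Γ p q i τ j → closeVar (p ∷ Γ) q i τ j ≡ ren there (closeVar Γ q i τ j)
  closeVar-lift Γ p q i τ j with τ ≟Ty ⌜ q ⌝ | j ℕ.≟ i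
  ... | yes refl | yes _ = refl
  ... | yes refl | no _  = refl
  ... | no _     | _     = refl

  close≡sub : ∀ Γ q i {τ} (t : Tm Γ τ) → close′ Γ q i t ≡ sub (closeSub Γ q i) t
  close≡sub Γ q i (fvar {τ} j) with τ ≟Ty ⌜ q ⌝ | j ℕ.≟ i
  ... | yes refl | yes _ = refl
  ... | yes refl | no _  = refl
  ... | no _     | _     = refl
  close≡sub Γ q i (bvar x)  = refl
  close≡sub Γ q i (con c)   = refl
  close≡sub Γ q i (app t s) = cong₂ app (close≡sub Γ q i t) (close≡sub Γ q i s)
  close≡sub Γ q i (imp φ ψ) = cong₂ imp (close≡sub Γ q i φ) (close≡sub Γ q i ψ)
  close≡sub Γ q i (all p φ) = cong (all p) (trans (close≡sub (p ∷ Γ) q i φ)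
    (sub-ext′ _ _ (λ { here → refl ; (there x) → refl }) (closeVar-lift Γ p q i) φ))

  closeVar-same : ∀ Γ q i → closeVar Γ q i ⌜ q ⌝ i ≡ bvar (lastIn Γ)
  closeVar-same Γ q i with ⌜ q ⌝ ≟Ty ⌜ q ⌝ | i ℕ.≟ i
  ... | yes refl | yes _  = refl
  ... | yes refl | no i≢i = ⊥-elim (i≢i refl)
  ... | no q≢q   | _      = ⊥-elim (q≢q refl)

  closeVar-other : ∀ Γ q i τ j → ¬ (τ ≡ ⌜ q ⌝ × j ≡ i) → closeVar Γ q i τ j ≡ fvar j
  closeVar-other Γ q i τ j ne with τ ≟Ty ⌜ q ⌝ | j ℕ.≟ i
  ... | yes refl | yes e = ⊥-elim (ne (refl , e))
  ... | yes refl | no _  = refl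
  ... | no _     | _     = refl

  instVar : ∀ Γ {q p} → Term ⌜ q ⌝ → (Γ ++ q ∷ []) ∋ p → Tm Γ ⌜ p ⌝
  instVar Γ t x with split Γ x
  ... | inj₁ y    = bvar y
  ... | inj₂ refl = wk [] t

  instSub : ∀ Γ {q} → Term ⌜ q ⌝ → Sub (Γ ++ q ∷ []) Γ
  onBound (instSub Γ t)     = instVar Γ t
  onFree  (instSub Γ t) τ k = fvar k

  instVar-lift : ∀ Γ p {q r} (t : Term ⌜ q ⌝) (x : (Γ ++ q ∷ []) ∋ r) →
                 instVar (p ∷ Γ) t (there x) ≡ ren there (instVar Γ t x)
  instVar-lift Γ p t x with split Γ x
  ... | inj₁ y    = refl
  ... | inj₂ refl = trans (wk-closed t) (sym (trans (cong (ren there) (wk-closed t)) (ren-embedded there t)))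

  inst≡sub : ∀ Γ {q τ} (u : Tm (Γ ++ q ∷ []) τ) (t : Term ⌜ q ⌝) → inst′ Γ u t ≡ sub (instSub Γ t) u
  inst≡sub Γ (fvar i) t = refl
  inst≡sub Γ (bvar x) t with split Γ x
  ... | inj₁ y    = refl
  ... | inj₂ refl = refl
  inst≡sub Γ (con c)   t = refl
  inst≡sub Γ (app u v) t = cong₂ app (inst≡sub Γ u t) (inst≡sub Γ v t)
  inst≡sub Γ (imp φ ψ) t = cong₂ imp (inst≡sub Γ φ t) (inst≡sub Γ ψ t)
  inst≡sub Γ (all p φ) t = cong (all p) (trans (inst≡sub (p ∷ Γ) φ t)
    (sub-ext′ _ _ (λ { here → refl ; (there x) → instVar-lift Γ p t x }) (λ _ _ → refl) φ))

  free-ren⁺ : ∀ {Γ Γ′ τ σ k} (ρ : Ren Γ Γ′) {t : Tm Γ σ} → FreeIn τ k t → FreeIn τ k (ren ρ t)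
  free-ren⁺ ρ var      = var
  free-ren⁺ ρ (appˡ f) = appˡ (free-ren⁺ ρ f)
  free-ren⁺ ρ (appʳ f) = appʳ (free-ren⁺ ρ f)
  free-ren⁺ ρ (impˡ f) = impˡ (free-ren⁺ ρ f)
  free-ren⁺ ρ (impʳ f) = impʳ (free-ren⁺ ρ f)
  free-ren⁺ ρ (all f)  = all (free-ren⁺ (liftRen ρ) f)

  free-ren⁻ : ∀ {Γ Γ′ τ σ k} (ρ : Ren Γ Γ′) (t : Tm Γ σ) → FreeIn τ k (ren ρ t) → FreeIn τ k t
  free-ren⁻ ρ (fvar i)  var      = var
  free-ren⁻ ρ (app t s) (appˡ f) = appˡ (free-ren⁻ ρ t f)
  free-ren⁻ ρ (app t s) (appʳ f) = appʳ (free-ren⁻ ρ s f)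
  free-ren⁻ ρ (imp φ ψ) (impˡ f) = impˡ (free-ren⁻ ρ φ f)
  free-ren⁻ ρ (imp φ ψ) (impʳ f) = impʳ (free-ren⁻ ρ ψ f)
  free-ren⁻ ρ (all q φ) (all f)  = all (free-ren⁻ (liftRen ρ) φ f)

  free-sub⁺ : ∀ {Γ Γ′ τ σ k τ′ j} (e : Sub Γ Γ′) {t : Tm Γ σ} → FreeIn τ k t →
              FreeIn τ′ j (onFree e τ k) → FreeIn τ′ j (sub e t)
  free-sub⁺ e var      g = g
  free-sub⁺ e (appˡ f) g = appˡ (free-sub⁺ e f g)
  free-sub⁺ e (appʳ f) g = appʳ (free-sub⁺ e f g)
  free-sub⁺ e (impˡ f) g = impˡ (free-sub⁺ e f g)
  free-sub⁺ e (impʳ f) g = impʳ (free-sub⁺ e f g)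
  free-sub⁺ e (all f)  g = all (free-sub⁺ (liftSub e) f (free-ren⁺ there g))

  FreeVia : ∀ {Γ Γ′ σ} → Sub Γ Γ′ → Tm Γ σ → Ty nB → ℕ → Set
  FreeVia {Γ} e t τ′ j =
    (Σ (Ty nB) λ τ → Σ ℕ λ k → FreeIn τ k t × FreeIn τ′ j (onFree e τ k)) ⊎
    (Σ (QTy nB) λ q → Σ (Γ ∋ q) λ x → FreeIn τ′ j (onBound e x))

  FreeVia-map : ∀ {Γ Γ′ σ σ′ τ′ j} {e : Sub Γ Γ′} {t : Tm Γ σ} {t′ : Tm Γ σ′} →
                (∀ {τ k} → FreeIn τ k t → FreeIn τ k t′) → FreeVia e t τ′ j → FreeVia e t′ τ′ j
  FreeVia-map g (inj₁ (τ , k , a , b)) = inj₁ (τ , k , g a , b)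
  FreeVia-map g (inj₂ r)               = inj₂ r

  free-sub⁻ : ∀ {Γ Γ′ σ τ′ j} (e : Sub Γ Γ′) (t : Tm Γ σ) → FreeIn τ′ j (sub e t) → FreeVia e t τ′ j
  free-sub⁻ e (fvar {τ} k) f = inj₁ (τ , k , var , f)
  free-sub⁻ e (bvar x)     f = inj₂ (_ , x , f)
  free-sub⁻ e (app t s) (appˡ f) = FreeVia-map appˡ (free-sub⁻ e t f)
  free-sub⁻ e (app t s) (appʳ f) = FreeVia-map appʳ (free-sub⁻ e s f)
  free-sub⁻ e (imp φ ψ) (impˡ f) = FreeVia-map impˡ (free-sub⁻ e φ f)
  free-sub⁻ e (imp φ ψ) (impʳ f) = FreeVia-map impʳ (free-sub⁻ e ψ f)
  free-sub⁻ e (all q φ) (all f) with free-sub⁻ (liftSub e) φ f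
  ... | inj₁ (τ , k , a , b)     = inj₁ (τ , k , all a , free-ren⁻ there (onFree e τ k) b)
  ... | inj₂ (p , here , ())
  ... | inj₂ (p , there x , b)   = inj₂ (p , x , free-ren⁻ there (onBound e x) b)

  free-subFree⁺ : ∀ {Γ τ σ k τ′ j} (θ : FreeSub) {t : Tm Γ σ} → FreeIn τ k t →
                  FreeIn τ′ j (θ τ k) → FreeIn τ′ j (subFree θ t)
  free-subFree⁺ θ {t} f g =
    subst (FreeIn _ _) (sym (subFree≡sub θ t)) (free-sub⁺ (freeSub θ) f (free-ren⁺ emptyRen g))

  free-subFree⁻ : ∀ {Γ σ τ′ j} (θ : FreeSub) (t : Tm Γ σ) → FreeIn τ′ j (subFree θ t) →
                  Σ (Ty nB) λ τ → Σ ℕ λ k → FreeIn τ k t × FreeIn τ′ j (θ τ k)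
  free-subFree⁻ θ t f with free-sub⁻ (freeSub θ) t (subst (FreeIn _ _) (subFree≡sub θ t) f)
  ... | inj₁ (τ , k , a , b) = τ , k , a , free-ren⁻ emptyRen (θ τ k) b

  free-inst⁻ : ∀ {q τ k} j (body : Tm (q ∷ []) o) → FreeIn τ k (inst body (fvar j)) →
               FreeIn τ k body ⊎ (τ ≡ ⌜ q ⌝ × k ≡ j)
  free-inst⁻ j body f with free-sub⁻ (instSub [] (fvar j)) body (subst (FreeIn _ _) (inst≡sub [] body (fvar j)) f)
  ... | inj₁ (τ , k , a , var) = inj₁ a
  ... | inj₂ (p , here , var)  = inj₂ (refl , refl)
  ... | inj₂ (p , there () , _)

  close-inst : ∀ {q} j (body : Tm (q ∷ []) o) → ¬ FreeIn ⌜ q ⌝ j body →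
               close′ [] q j (inst body (fvar j)) ≡ body
  close-inst {q} j body j∉body = begin
      close′ [] q j (inst body (fvar j))
    ≡⟨ close≡sub [] q j (inst body (fvar j)) ⟩
      sub (closeSub [] q j) (inst body (fvar j))
    ≡⟨ cong (sub (closeSub [] q j)) (inst≡sub [] body (fvar j)) ⟩
      sub (closeSub [] q j) (sub (instSub [] (fvar j)) body)
    ≡⟨ sub-sub _ _ body ⟩
      sub (closeSub [] q j ∘ₛ instSub [] (fvar j)) body
    ≡⟨ sub-ext _ idSub (λ { here → closeVar-same [] q j ; (there ()) }) body
         (λ σ k f → closeVar-other [] q j σ k (λ { (refl , refl) → j∉body f })) ⟩
      sub idSub body
    ≡⟨ sub-id idSub (λ x → refl) (λ _ _ → refl) body ⟩
      body
    ∎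

  subFree-inst : ∀ {q} (θ : FreeSub) (body : Tm (q ∷ []) o) (t : Term ⌜ q ⌝) →
                 subFree θ (inst body t) ≡ inst (subFree θ body) (subFree θ t)
  subFree-inst {q} θ body t = begin
      subFree θ (inst body t)                                ≡⟨ subFree≡sub θ (inst body t) ⟩
      sub (freeSub θ) (inst body t)                          ≡⟨ cong (sub (freeSub θ)) (inst≡sub [] body t) ⟩
      sub (freeSub θ) (sub (instSub [] t) body)              ≡⟨ sub-sub _ _ body ⟩
      sub (freeSub θ ∘ₛ instSub [] t) body                   ≡⟨ sub-ext′ _ _ bound free body ⟩
      sub (instSub [] (subFree θ t) ∘ₛ freeSub θ) body       ≡⟨ sym (sub-sub _ _ body) ⟩
      sub (instSub [] (subFree θ t)) (sub (freeSub θ) body)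
        ≡⟨ cong (sub (instSub [] (subFree θ t))) (sym (subFree≡sub θ body)) ⟩
      sub (instSub [] (subFree θ t)) (subFree θ body)        ≡⟨ sym (inst≡sub [] (subFree θ body) (subFree θ t)) ⟩
      inst (subFree θ body) (subFree θ t)                    ∎
    where
    bound : ∀ {p} (x : (q ∷ []) ∋ p) →
            onBound (freeSub θ ∘ₛ instSub [] t) x ≡ onBound (instSub [] (subFree θ t) ∘ₛ freeSub θ) x
    bound here = begin
      sub (freeSub θ) (wk [] t)  ≡⟨ cong (sub (freeSub θ)) (wk-closed-id t) ⟩
      sub (freeSub θ) t          ≡⟨ sym (subFree≡sub θ t) ⟩
      subFree θ t                ≡⟨ sym (wk-closed-id (subFree θ t)) ⟩
      wk [] (subFree θ t)        ∎
    bound (there ())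
    free : ∀ σ k → ren emptyRen (θ σ k) ≡ sub (instSub [] (subFree θ t)) (ren emptyRen (θ σ k))
    free σ k = trans (ren-closed (θ σ k)) (sym (sub-closed (instSub [] (subFree θ t)) (λ _ _ → refl) (θ σ k)))

  inst-subFree-close : ∀ q i (θ θ′ : FreeSub) (φ : Formula) (t : Term ⌜ q ⌝) → θ′ ⌜ q ⌝ i ≡ t →
                       (∀ τ k → FreeIn τ k φ → ¬ (τ ≡ ⌜ q ⌝ × k ≡ i) → θ′ τ k ≡ θ τ k) →
                       inst (subFree θ (close′ [] q i φ)) t ≡ subFree θ′ φ
  inst-subFree-close q i θ θ′ φ t θ′i≡t θ′≡θ = begin
      inst (subFree θ (close′ [] q i φ)) t
    ≡⟨ inst≡sub [] (subFree θ (close′ [] q i φ)) t ⟩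
      sub (instSub [] t) (subFree θ (close′ [] q i φ))
    ≡⟨ cong (sub (instSub [] t)) (trans (subFree≡sub θ (close′ [] q i φ))
                                        (cong (sub (freeSub θ)) (close≡sub [] q i φ))) ⟩
      sub (instSub [] t) (sub (freeSub θ) (sub (closeSub [] q i) φ))
    ≡⟨ cong (sub (instSub [] t)) (sub-sub _ _ φ) ⟩
      sub (instSub [] t) (sub (freeSub θ ∘ₛ closeSub [] q i) φ)
    ≡⟨ sub-sub _ _ φ ⟩
      sub (instSub [] t ∘ₛ (freeSub θ ∘ₛ closeSub [] q i)) φ
    ≡⟨ sub-ext _ _ (λ ()) φ agree ⟩
      sub (freeSub θ′) φ
    ≡⟨ sym (subFree≡sub θ′ φ) ⟩
      subFree θ′ φ
    ∎
    where
    agree : ∀ τ k → FreeIn τ k φ →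
            sub (instSub [] t) (sub (freeSub θ) (closeVar [] q i τ k)) ≡ ren emptyRen (θ′ τ k)
    agree τ k f with (τ ≟Ty ⌜ q ⌝) ×-dec (k ℕ.≟ i)
    ... | yes (refl , refl) = begin
      sub (instSub [] t) (sub (freeSub θ) (closeVar [] q i ⌜ q ⌝ i))
        ≡⟨ cong (λ z → sub (instSub [] t) (sub (freeSub θ) z)) (closeVar-same [] q i) ⟩
      wk [] t                   ≡⟨ wk-closed-id t ⟩
      t                         ≡⟨ sym θ′i≡t ⟩
      θ′ ⌜ q ⌝ i                ≡⟨ sym (ren-closed _) ⟩
      ren emptyRen (θ′ ⌜ q ⌝ i) ∎
    ... | no x≢xᵢ = begin
      sub (instSub [] t) (sub (freeSub θ) (closeVar [] q i τ k))
        ≡⟨ cong (λ z → sub (instSub [] t) (sub (freeSub θ) z)) (closeVar-other [] q i τ k x≢xᵢ) ⟩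
      sub (instSub [] t) (ren emptyRen (θ τ k))  ≡⟨ sub-closed (instSub [] t) (λ _ _ → refl) (θ τ k) ⟩
      θ τ k                                      ≡⟨ sym (θ′≡θ τ k f x≢xᵢ) ⟩
      θ′ τ k                                     ≡⟨ sym (ren-closed _) ⟩
      ren emptyRen (θ′ τ k)                      ∎

  close-subFree-close : ∀ q i j (θ θ′ : FreeSub) (φ : Formula) → θ′ ⌜ q ⌝ i ≡ fvar j →
                        (∀ τ k → FreeIn τ k φ → ¬ (τ ≡ ⌜ q ⌝ × k ≡ i) → θ′ τ k ≡ θ τ k) →
                        ¬ FreeIn ⌜ q ⌝ j (subFree θ (close′ [] q i φ)) →
                        close′ [] q j (subFree θ′ φ) ≡ subFree θ (close′ [] q i φ)
  close-subFree-close q i j θ θ′ φ θ′i≡j θ′≡θ j-fresh = begin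
      close′ [] q j (subFree θ′ φ)
    ≡⟨ cong (close′ [] q j) (sym (inst-subFree-close q i θ θ′ φ (fvar j) θ′i≡j θ′≡θ)) ⟩
      close′ [] q j (inst (subFree θ (close′ [] q i φ)) (fvar j))
    ≡⟨ close-inst j (subFree θ (close′ [] q i φ)) j-fresh ⟩
      subFree θ (close′ [] q i φ)
    ∎

  -- Term size: the measure for inductions over formulas that pass from
  -- all q body to the instance  inst body (fvar j).
  size : ∀ {Γ τ} → Tm Γ τ → ℕ
  size (fvar i)  = 1
  size (bvar x)  = 1
  size (con c)   = 1
  size (app t s) = suc (size t + size s)
  size (imp φ ψ) = suc (size φ + size ψ)
  size (all q φ) = suc (size φ)

  size-inst : ∀ Γ {q τ} j (u : Tm (Γ ++ q ∷ []) τ) → size (inst′ Γ u (fvar j)) ≡ size u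
  size-inst Γ j (fvar i) = refl
  size-inst Γ j (bvar x) with split Γ x
  ... | inj₁ y    = refl
  ... | inj₂ refl = refl
  size-inst Γ j (con c)   = refl
  size-inst Γ j (app t s) = cong₂ (λ a b → suc (a + b)) (size-inst Γ j t) (size-inst Γ j s)
  size-inst Γ j (imp φ ψ) = cong₂ (λ a b → suc (a + b)) (size-inst Γ j φ) (size-inst Γ j ψ)
  size-inst Γ j (all p φ) = cong suc (size-inst (p ∷ Γ) j φ)

  fvBound : ∀ {Γ τ} → Tm Γ τ → ℕ
  fvBound (fvar i)  = suc i
  fvBound (bvar x)  = 0
  fvBound (con c)   = 0
  fvBound (app t s) = fvBound t ⊔ fvBound s
  fvBound (imp φ ψ) = fvBound φ ⊔ fvBound ψ
  fvBound (all q φ) = fvBound φ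

  fvBound-free : ∀ {Γ τ σ k} {t : Tm Γ σ} → FreeIn τ k t → k < fvBound t
  fvBound-free var = ≤-refl
  fvBound-free {t = app t s} (appˡ f) = <-≤-trans (fvBound-free f) (m≤m⊔n (fvBound t) (fvBound s))
  fvBound-free {t = app t s} (appʳ f) = <-≤-trans (fvBound-free f) (m≤n⊔m (fvBound t) (fvBound s))
  fvBound-free {t = imp φ ψ} (impˡ f) = <-≤-trans (fvBound-free f) (m≤m⊔n (fvBound φ) (fvBound ψ))
  fvBound-free {t = imp φ ψ} (impʳ f) = <-≤-trans (fvBound-free f) (m≤n⊔m (fvBound φ) (fvBound ψ))
  fvBound-free (all f) = fvBound-free f

  fresh : ∀ {Γ τ σ k} (t : Tm Γ σ) → fvBound t ≤ k → ¬ FreeIn τ k t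
  fresh t le f = <⇒≱ (fvBound-free f) le

  fvBoundL : List Formula → ℕ
  fvBoundL []      = 0
  fvBoundL (φ ∷ L) = fvBound φ ⊔ fvBoundL L

  freshL : ∀ {τ k} (L : List Formula) → fvBoundL L ≤ k → ¬ Any (FreeIn τ k) L
  freshL (φ ∷ L) le (Any.here f)  = fresh φ (≤-trans (m≤m⊔n (fvBound φ) (fvBoundL L)) le) f
  freshL (φ ∷ L) le (Any.there a) = freshL L (≤-trans (m≤n⊔m (fvBound φ) (fvBoundL L)) le) a

  update-same : ∀ {ℓ} (D : Ty nB → Set ℓ) u τ i d → update D u τ i d τ i ≡ d
  update-same D u τ i d with τ ≟Ty τ | i ℕ.≟ i
  ... | yes refl | yes _  = refl
  ... | yes refl | no i≢i = ⊥-elim (i≢i refl)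
  ... | no τ≢τ   | _      = ⊥-elim (τ≢τ refl)

  update-other : ∀ {ℓ} (D : Ty nB → Set ℓ) u τ i d σ j → ¬ (σ ≡ τ × j ≡ i) →
                 update D u τ i d σ j ≡ u σ j
  update-other D u τ i d σ j ne with σ ≟Ty τ | j ℕ.≟ i
  ... | yes refl | yes e = ⊥-elim (ne (refl , e))
  ... | yes refl | no _  = refl
  ... | no _     | _     = refl

  close-subFree-open : ∀ {q} j (θ : FreeSub) (body : Tm (q ∷ []) o) → ¬ FreeIn ⌜ q ⌝ j body →
                       ¬ FreeIn ⌜ q ⌝ j (subFree θ body) →
                       close′ [] q j (subFree (update Term θ ⌜ q ⌝ j (fvar j)) (inst body (fvar j))) ≡ subFree θ body
  close-subFree-open {q} j θ body j∉body j∉θbody = trans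
    (close-subFree-close q j j θ (update Term θ ⌜ q ⌝ j (fvar j)) (inst body (fvar j))
      (update-same Term θ ⌜ q ⌝ j (fvar j)) (λ τ k _ ne → update-other Term θ ⌜ q ⌝ j (fvar j) τ k ne)
      (subst (λ b → ¬ FreeIn ⌜ q ⌝ j (subFree θ b)) (sym reopened) j∉θbody))
    (cong (subFree θ) reopened)
    where
    reopened : close′ [] q j (inst body (fvar j)) ≡ body
    reopened = close-inst j body j∉body

  -- Derivability is closed under substitution of free variables.  In the ∀I
  -- case the eigenvariable is renamed to one fresh for the new hypotheses.
  ⊢₀-subst : ∀ (θ : FreeSub) {Γ Γ′ φ} → Γ ⊢₀ φ → (∀ {ψ} → ψ ∈ Γ → subFree θ ψ ∈ Γ′) →
             Γ′ ⊢₀ subFree θ φ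
  ⊢₀-subst θ (ax m)    h = ax (h m)
  ⊢₀-subst θ (⊃I d)    h =
    ⊃I (⊢₀-subst θ d (λ { (Any.here refl) → Any.here refl ; (Any.there m) → Any.there (h m) }))
  ⊢₀-subst θ (⊃E d e)  h = ⊃E (⊢₀-subst θ d h) (⊢₀-subst θ e h)
  ⊢₀-subst θ {Γ} {Γ′} (∀I {φ} q i i∉Γ d) h =
      subst (Γ′ ⊢₀_) (cong (all q) renamed) (∀I q j (freshL Γ′ (m≤m⊔n _ _)) (⊢₀-subst θ′ d h′))
    where
    j  = fvBoundL Γ′ ⊔ fvBound (subFree θ (close′ [] q i φ))
    θ′ = update Term θ ⌜ q ⌝ i (fvar j)
    renamed : close′ [] q j (subFree θ′ φ) ≡ subFree θ (close′ [] q i φ)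
    renamed = close-subFree-close q i j θ θ′ φ (update-same Term θ ⌜ q ⌝ i (fvar j))
                (λ τ k _ ne → update-other Term θ ⌜ q ⌝ i (fvar j) τ k ne) (fresh _ (m≤n⊔m (fvBoundL Γ′) _))
    h′ : ∀ {ψ} → ψ ∈ Γ → subFree θ′ ψ ∈ Γ′
    h′ {ψ} m = subst (_∈ Γ′) (subFree-ext θ θ′ ψ (λ σ k f → sym (update-other Term θ ⌜ q ⌝ i (fvar j) σ k
                 (λ { (refl , refl) → i∉Γ (lose m f) })))) (h m)
  ⊢₀-subst θ {Γ′ = Γ′} (∀E {body = body} d t) h =
    subst (Γ′ ⊢₀_) (sym (subFree-inst θ body t)) (∀E (⊢₀-subst θ d h) (subFree θ t))

  -- Weakening, as the identity substitution (a direct induction would fail at ∀I).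
  ⊢₀-weaken : ∀ {Γ Γ′ φ} → Γ ⊢₀ φ → Γ ⊆ Γ′ → Γ′ ⊢₀ φ
  ⊢₀-weaken {Γ′ = Γ′} {φ} d h = subst (Γ′ ⊢₀_) (subFree-id φ)
    (⊢₀-subst varSub d (λ {ψ} m → subst (_∈ Γ′) (sym (subFree-id ψ)) (h m)))

module Soundness (nB : ℕ) (Con : Ty nB → Set) where
  open PRED2 nB Con
  open Syntax nB Con
  open ≡-Reasoning

  module InModel {ℓ} (M : PreModel ℓ) (K : IsKripke M) where
    open PreModel M renaming (_≤_ to _⊑_)
    open IsKripke K

    ⊑-refl : ∀ {s} → s ⊑ s
    ⊑-refl = IsPartialOrder.refl ≤-po

    -- Semantic equality of values: the interpretation ⟦_⟧ of a pre-model is only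
    -- constrained up to forcing, so propositions are compared by the states
    -- forcing them, and all other values by equality.
    _≈_ : ∀ {τ} → D τ → D τ → Set ℓ
    _≈_ {o}     a b = ∀ s → ς a s ⇔ ς b s
    _≈_ {base β} a b = a ≡ b
    _≈_ {β ⇒ τ} a b = a ≡ b

    ≡→≈ : ∀ {τ} {a b : D τ} → a ≡ b → a ≈ b
    ≡→≈ {o}     refl s = ⇔-refl
    ≡→≈ {base β} e     = e
    ≡→≈ {β ⇒ τ} e     = e

    ≈-trans : ∀ {τ} {a b c : D τ} → a ≈ b → b ≈ c → a ≈ c
    ≈-trans {o}     p q s = ⇔-trans (p s) (q s)
    ≈-trans {base β} p q   = trans p q
    ≈-trans {β ⇒ τ} p q   = trans p q

    forces-≡ : ∀ {s u φ ψ} → φ ≡ ψ → (s , u ⊩ φ) ⇔ (s , u ⊩ ψ)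
    forces-≡ refl = ⇔-refl

    Agree : ∀ {τ} → FreeSub → Val → Val → Term τ → Set ℓ
    Agree θ u v t = ∀ τ k → FreeIn τ k t → ⟦ θ τ k ⟧ u ≈ v τ k

    eval-var : ∀ {τ} θ u v k → ⟦ θ τ k ⟧ u ≈ v τ k → ⟦ subFree θ (fvar {[]} {τ} k) ⟧ u ≈ ⟦ fvar k ⟧ v
    eval-var {τ} θ u v k h =
      ≈-trans (≡→≈ (cong (λ t → ⟦ t ⟧ u) (ren-closed (θ τ k)))) (≈-trans h (≡→≈ (sym (⟦var⟧ k v))))

    eval-con : ∀ {τ} (c : Con τ) u v → ⟦ con c ⟧ u ≡ ⟦ con c ⟧ v
    eval-con c u v = trans (⟦con⟧ c u) (sym (⟦con⟧ c v))

    ⊩imp-cong : ∀ {s u v φ ψ φ′ ψ′} → (∀ s′ → (s′ , u ⊩ φ) ⇔ (s′ , v ⊩ φ′)) →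
                (∀ s′ → (s′ , u ⊩ ψ) ⇔ (s′ , v ⊩ ψ′)) → (s , u ⊩ imp φ ψ) ⇔ (s , v ⊩ imp φ′ ψ′)
    ⊩imp-cong {s} {u} {v} {φ} {ψ} {φ′} {ψ′} hφ hψ = mk⇔
      (λ x → from (⊩imp s v φ′ ψ′) λ s′ s⊑s′ y →
               to (hψ s′) (to (⊩imp s u φ ψ) x s′ s⊑s′ (from (hφ s′) y)))
      (λ x → from (⊩imp s u φ ψ) λ s′ s⊑s′ y →
               from (hψ s′) (to (⊩imp s v φ′ ψ′) x s′ s⊑s′ (to (hφ s′) y)))

    ⊩all-cong : ∀ {s u v q i j φ φ′} →
                (∀ s′ d → (s′ , u [ ⌜ q ⌝ , i ↦ d ] ⊩ φ) ⇔ (s′ , v [ ⌜ q ⌝ , j ↦ d ] ⊩ φ′)) →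
                (s , u ⊩ ∀[ q , i ] φ) ⇔ (s , v ⊩ ∀[ q , j ] φ′)
    ⊩all-cong {s} {u} {v} {q} {i} {j} {φ} {φ′} h = mk⇔
      (λ x → from (⊩all s v q j φ′) (λ s′ s⊑s′ d → to (h s′ d) (to (⊩all s u q i φ) x s′ s⊑s′ d)))
      (λ x → from (⊩all s u q i φ) (λ s′ s⊑s′ d → from (h s′ d) (to (⊩all s v q j φ′) x s′ s⊑s′ d)))

    -- Every θ is stable (lemma `stable`), but only as a consequence of the
    -- coincidence lemma, whose proof needs the stable substitutions below.
    Stable : FreeSub → Set ℓ
    Stable θ = ∀ u τ′ j (d : D τ′) τ k → ¬ FreeIn τ′ j (θ τ k) →
               ⟦ θ τ k ⟧ (u [ τ′ , j ↦ d ]) ≈ ⟦ θ τ k ⟧ u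

    stable-var : Stable varSub
    stable-var u τ′ j d τ k j∉ = ≡→≈ (begin
      ⟦ fvar k ⟧ (u [ τ′ , j ↦ d ])  ≡⟨ ⟦var⟧ k _ ⟩
      (u [ τ′ , j ↦ d ]) τ k         ≡⟨ update-other D u τ′ j d τ k (λ { (refl , refl) → j∉ var }) ⟩
      u τ k                          ≡⟨ sym (⟦var⟧ k u) ⟩
      ⟦ fvar k ⟧ u                   ∎)

    -- Sending one more variable to itself preserves stability; the `with` on the
    -- same tests as in `update` makes the updated substitution compute.
    stable-update : ∀ θ → Stable θ → ∀ τ₀ j₀ → Stable (update Term θ τ₀ j₀ (fvar j₀))
    stable-update θ st τ₀ j₀ u τ′ j d τ k j∉ with τ ≟Ty τ₀ | k ℕ.≟ j₀
    ... | yes refl | yes refl = stable-var u τ′ j d τ k j∉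
    ... | yes refl | no _     = st u τ′ j d τ k j∉
    ... | no _     | _        = st u τ′ j d τ k j∉

    -- Opening a quantifier at a variable x_j fresh for both sides, and sending x_j
    -- to the same d on both sides, preserves agreement: x_j goes to itself, hence to
    -- d; every other free variable of the instance is free in the body, where the
    -- updated θ is θ and where x_j does not occur.
    agree-open : ∀ {q} θ → Stable θ → ∀ u v (body : Tm (q ∷ []) o) → Agree θ u v (all q body) →
                 ∀ j → (∀ {τ} → ¬ FreeIn τ j body) → (∀ {τ} → ¬ FreeIn τ j (subFree θ body)) → ∀ d →
                 Agree (update Term θ ⌜ q ⌝ j (fvar j)) (u [ ⌜ q ⌝ , j ↦ d ]) (v [ ⌜ q ⌝ , j ↦ d ])
                       (inst body (fvar j))
    agree-open {q} θ st u v body ag j j∉body j∉θbody d τ k f with free-inst⁻ j body f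
    ... | inj₂ (refl , refl) = ≡→≈ (begin
      ⟦ update Term θ ⌜ q ⌝ j (fvar j) ⌜ q ⌝ j ⟧ u′
        ≡⟨ cong (λ t → ⟦ t ⟧ u′) (update-same Term θ ⌜ q ⌝ j (fvar j)) ⟩
      ⟦ fvar j ⟧ u′                  ≡⟨ ⟦var⟧ j u′ ⟩
      u′ ⌜ q ⌝ j                     ≡⟨ update-same D u ⌜ q ⌝ j d ⟩
      d                              ≡⟨ sym (update-same D v ⌜ q ⌝ j d) ⟩
      (v [ ⌜ q ⌝ , j ↦ d ]) ⌜ q ⌝ j  ∎)
      where
      u′ = u [ ⌜ q ⌝ , j ↦ d ]
    ... | inj₁ g =
      ≈-trans (≡→≈ (cong (λ t → ⟦ t ⟧ (u [ ⌜ q ⌝ , j ↦ d ]))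
                         (update-other Term θ ⌜ q ⌝ j (fvar j) τ k k≢j)))
      (≈-trans (st u ⌜ q ⌝ j d τ k (λ h → j∉θbody (free-subFree⁺ θ g h)))
      (≈-trans (ag τ k (all g))
               (≡→≈ (sym (update-other D v ⌜ q ⌝ j d τ k k≢j)))))
      where
      k≢j : ¬ (τ ≡ ⌜ q ⌝ × k ≡ j)
      k≢j (_ , refl) = j∉body g

    -- A quantifier body is opened with a variable x_j fresh for both sides.
    eval-subFree : ∀ n {τ} (t : Term τ) → size t ≤ n → ∀ θ → Stable θ → ∀ u v → Agree θ u v t →
                   ⟦ subFree θ t ⟧ u ≈ ⟦ t ⟧ v
    eval-subFree n (fvar k)  _ θ _ u v ag = eval-var θ u v k (ag _ k var)
    eval-subFree n (bvar ())
    eval-subFree n (con c)   _ θ _ u v _  = ≡→≈ (eval-con c u v)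
    eval-subFree (suc n) (app t s) (s≤s le) θ st u v ag = ≡→≈ (begin
      ⟦ app (subFree θ t) (subFree θ s) ⟧ u  ≡⟨ ⟦app⟧ (subFree θ t) (subFree θ s) u ⟩
      ⟦ subFree θ t ⟧ u · ⟦ subFree θ s ⟧ u
        ≡⟨ cong₂ _·_
             (eval-subFree n t (≤-trans (m≤m+n (size t) (size s)) le) θ st u v (λ τ k f → ag τ k (appˡ f)))
             (eval-subFree n s (≤-trans (m≤n+m (size s) (size t)) le) θ st u v (λ τ k f → ag τ k (appʳ f))) ⟩
      ⟦ t ⟧ v · ⟦ s ⟧ v                      ≡⟨ sym (⟦app⟧ t s v) ⟩
      ⟦ app t s ⟧ v                          ∎)
    eval-subFree (suc n) (imp φ ψ) (s≤s le) θ st u v ag s = ⊩imp-cong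
      (eval-subFree n φ (≤-trans (m≤m+n (size φ) (size ψ)) le) θ st u v (λ τ k f → ag τ k (impˡ f)))
      (eval-subFree n ψ (≤-trans (m≤n+m (size ψ) (size φ)) le) θ st u v (λ τ k f → ag τ k (impʳ f)))
    eval-subFree (suc n) (all q body) (s≤s le) θ st u v ag s =
      ⇔-trans (forces-≡ (cong (all q) (sym (close-subFree-open j θ body j∉body j∉θbody))))
        (⇔-trans (⊩all-cong λ s′ d →
                    eval-subFree n ψ size-ψ θ′ (stable-update θ st ⌜ q ⌝ j) _ _
                      (agree-open θ st u v body ag j j∉body j∉θbody d) s′)
                 (forces-≡ (cong (all q) (close-inst j body j∉body))))
      where
      j  = fvBound body ⊔ fvBound (subFree θ body)
      ψ  = inst body (fvar j)
      θ′ = update Term θ ⌜ q ⌝ j (fvar j)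

      j∉body : ∀ {τ} → ¬ FreeIn τ j body
      j∉body = fresh body (m≤m⊔n _ _)

      j∉θbody : ∀ {τ} → ¬ FreeIn τ j (subFree θ body)
      j∉θbody = fresh (subFree θ body) (m≤n⊔m (fvBound body) _)

      size-ψ : size ψ ≤ n
      size-ψ = subst (_≤ n) (sym (size-inst [] j body)) le

    coincidence : ∀ {τ} (t : Term τ) u v → (∀ τ k → FreeIn τ k t → u τ k ≈ v τ k) → ⟦ t ⟧ u ≈ ⟦ t ⟧ v
    coincidence t u v h = ≈-trans (≡→≈ (cong (λ z → ⟦ z ⟧ u) (sym (subFree-id t))))
      (eval-subFree (size t) t ≤-refl varSub stable-var u v (λ τ k f → ≈-trans (≡→≈ (⟦var⟧ k u)) (h τ k f)))

    stable : ∀ θ → Stable θ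
    stable θ u τ′ j d τ k j∉ = coincidence (θ τ k) _ u (λ σ m f → ≡→≈ (update-other D u τ′ j d σ m
                                 (λ { (refl , refl) → j∉ f })))

    sound₀ : ∀ {Γ φ} → Γ ⊢₀ φ → ∀ s u → (∀ ψ → ψ ∈ Γ → s , u ⊩ ψ) → s , u ⊩ φ
    sound₀ (ax m) s u H = H _ m
    sound₀ (⊃I {φ} {ψ} d) s u H = from (⊩imp s u φ ψ) (λ s′ s⊑s′ sφ → sound₀ d s′ u
      (λ { χ (Any.here refl) → sφ ; χ (Any.there m) → ς-up _ s⊑s′ (H χ m) }))
    sound₀ (⊃E {φ} {ψ} d e) s u H = to (⊩imp s u φ ψ) (sound₀ d s u H) s ⊑-refl (sound₀ e s u H)
    sound₀ {Γ} (∀I {φ} q i i∉Γ d) s u H = from (⊩all s u q i φ) λ s′ s⊑s′ d′ →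
      sound₀ d s′ (u [ ⌜ q ⌝ , i ↦ d′ ]) (λ ψ m → to (unaffected d′ ψ m s′) (ς-up _ s⊑s′ (H ψ m)))
      where
      -- the eigenvariable is not free in the hypotheses, so updating it leaves them forced
      unaffected : ∀ d′ ψ → ψ ∈ Γ → ⟦ ψ ⟧ u ≈ ⟦ ψ ⟧ (u [ ⌜ q ⌝ , i ↦ d′ ])
      unaffected d′ ψ m = coincidence ψ u _ λ τ k f →
        ≡→≈ (sym (update-other D u ⌜ q ⌝ i d′ τ k (λ { (refl , refl) → i∉Γ (lose m f) })))
    sound₀ (∀E {q} {body} d t) s u H =
      to (forces-≡ substituted) (from (eval-subFree (size ψ) ψ ≤-refl θ (stable θ) u v agree s) forced)
      where
      -- read ∀x.body as ∀x_j.ψ with x_j fresh, and evaluate ψ with x_j ↦ ⟦t⟧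
      j = fvBound body
      ψ = inst body (fvar j)
      θ = update Term varSub ⌜ q ⌝ j t
      v = u [ ⌜ q ⌝ , j ↦ ⟦ t ⟧ u ]

      opened : close′ [] q j ψ ≡ body
      opened = close-inst j body (fresh body ≤-refl)

      forced : s , v ⊩ ψ
      forced = to (⊩all s u q j ψ) (to (forces-≡ (cong (all q) (sym opened))) (sound₀ d s u H))
                  s ⊑-refl (⟦ t ⟧ u)

      substituted : subFree θ ψ ≡ inst body t
      substituted = begin
        subFree θ ψ
          ≡⟨ sym (inst-subFree-close q j varSub θ ψ t (update-same Term varSub ⌜ q ⌝ j t)
                   (λ τ k _ ne → update-other Term varSub ⌜ q ⌝ j t τ k ne)) ⟩
        inst (subFree varSub (close′ [] q j ψ)) t
          ≡⟨ cong (λ b → inst b t) (trans (subFree-id _) opened) ⟩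
        inst body t
          ∎

      agree : Agree θ u v ψ
      agree τ k f with (τ ≟Ty ⌜ q ⌝) ×-dec (k ℕ.≟ j)
      ... | yes (refl , refl) = ≡→≈ (trans (cong (λ z → ⟦ z ⟧ u) (update-same Term varSub ⌜ q ⌝ j t))
                                           (sym (update-same D u ⌜ q ⌝ j (⟦ t ⟧ u))))
      ... | no ne = ≡→≈ (trans (cong (λ z → ⟦ z ⟧ u) (update-other Term varSub ⌜ q ⌝ j t τ k ne))
                        (trans (⟦var⟧ k u) (sym (update-other D u ⌜ q ⌝ j (⟦ t ⟧ u) τ k ne))))

  soundness : ∀ ℓ (Δ : Formula → Set) φ → Δ ⊢ φ → Δ ⊩⟨ ℓ ⟩ φ
  soundness ℓ Δ φ (Γ , Γ⊆Δ , d) M K s u H = InModel.sound₀ M K d s u (λ ψ m → H ψ (All.lookup Γ⊆Δ m))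

module Completeness (nB : ℕ) (Con : Ty nB → Set) (em : ExcludedMiddle lzero) where
  open PRED2 nB Con
  open Syntax nB Con

  ⊥f : Formula
  ⊥f = all qo (bvar here)

  explode : ∀ {Γ} → Γ ⊢₀ ⊥f → ∀ φ → Γ ⊢₀ φ
  explode {Γ} d φ = subst (Γ ⊢₀_) (wk-closed-id φ) (∀E d φ)

  -- The hypotheses are moved to even variables, so that odd variables are fresh
  -- for every finite set of them at once; moving back undoes this.
  toEven : FreeSub
  toEven τ k = fvar (k + k)

  fromEven : FreeSub
  fromEven τ k = fvar ⌊ k /2⌋

  fromEven-toEven : ∀ (φ : Formula) → subFree fromEven (subFree toEven φ) ≡ φ
  fromEven-toEven φ = trans (subFree-subFree fromEven toEven φ)
    (trans (subFree-ext _ _ φ (λ τ k _ → cong fvar (sym (n≡⌊n+n/2⌋ k)))) (subFree-id φ))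

  odd≢even : ∀ n k → suc (n + n) ≢ k + k
  odd≢even n k e = even≢odd k n (trans (double k) (trans (sym e) (cong suc (sym (double n)))))
    where
    double : ∀ m → 2 * m ≡ m + m
    double m = cong (m +_) (+-identityʳ m)

  fvar-index : ∀ {Γ τ σ j k} → FreeIn τ j (fvar {Γ} {σ} k) → j ≡ k
  fvar-index var = refl

  odd∉toEven : ∀ {τ} n (ψ : Formula) → ¬ FreeIn τ (suc (n + n)) (subFree toEven ψ)
  odd∉toEven n ψ f with free-subFree⁻ toEven ψ f
  ... | _ , k , _ , g = odd≢even n k (fvar-index g)

  module Canonical (Δ : Formula → Set) where

    Δₑ : Formula → Set
    Δₑ ψ′ = Σ Formula λ ψ → Δ ψ × subFree toEven ψ ≡ ψ′

    Der : List Formula → Formula → Set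
    Der L χ = Σ (List Formula) λ G → All Δₑ G × (L ++ G ⊢₀ χ)

    Der-weaken : ∀ M {L χ} → Der L χ → Der (M ++ L) χ
    Der-weaken M {L} (G , G⊆Δₑ , d) = G , G⊆Δₑ , ⊢₀-weaken d (Subset.++⁺ˡ G (Subset.xs⊆ys++xs L M))

    Der-mp : ∀ {L φ ψ} → Der L (imp φ ψ) → Der L φ → Der L ψ
    Der-mp {L} (G₁ , G₁⊆Δₑ , d₁) (G₂ , G₂⊆Δₑ , d₂) = G₁ ++ G₂ , AllP.++⁺ G₁⊆Δₑ G₂⊆Δₑ ,
      ⊃E (⊢₀-weaken d₁ (Subset.++⁺ʳ L (Subset.xs⊆xs++ys G₁ G₂)))
         (⊢₀-weaken d₂ (Subset.++⁺ʳ L (Subset.xs⊆ys++xs G₂ G₁)))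

    odd∉Δₑ : ∀ {τ} n {G} → All Δₑ G → ¬ Any (FreeIn τ (suc (n + n))) G
    odd∉Δₑ n ((ψ , _ , refl) ∷ _) (Any.here f)  = odd∉toEven n ψ f
    odd∉Δₑ n (_ ∷ G⊆Δₑ)          (Any.there f) = odd∉Δₑ n G⊆Δₑ f

    module _ (ℓ : Level) where

      -- States are finite lists of formulas consistent with Δₑ.  Consistency is an
      -- irrelevant field, so two states are equal as soon as their lists are.
      record State : Set ℓ where
        constructor ⟨_,_⟩
        field
          formulas    : List Formula
          .consistent : ¬ Der formulas ⊥f
      open State

      state-≡ : ∀ {s s′ : State} → formulas s ≡ formulas s′ → s ≡ s′
      state-≡ {⟨ L , _ ⟩} {⟨ .L , _ ⟩} refl = refl

      record _⊑_ (s s′ : State) : Set ℓ where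
        constructor extends
        field
          added   : List Formula
          extends : formulas s′ ≡ added ++ formulas s

      ⊑-po : IsPartialOrder _≡_ _⊑_
      ⊑-po = record
        { isPreorder = record
          { isEquivalence = isEquivalence
          ; reflexive     = λ { refl → extends [] refl }
          ; trans         = λ { {s} (extends M e₁) (extends N e₂) →
                              extends (N ++ M) (trans e₂ (trans (cong (N ++_) e₁) (sym (++-assoc N M (formulas s))))) }
          }
        ; antisym = λ { {s} {s′} (extends M e₁) (extends N e₂) → state-≡ (sym (no-proper-cycle M N e₁ e₂)) }
        }
        where
        no-proper-cycle : ∀ {xs ys : List Formula} M N → ys ≡ M ++ xs → xs ≡ N ++ ys → ys ≡ xs
        no-proper-cycle {xs} M N e₁ e₂ with ++-identityˡ-unique (N ++ M)
                                           (trans e₂ (trans (cong (N ++_) e₁) (sym (++-assoc N M xs))))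
        ... | N++M≡[] rewrite ++-conicalʳ N M N++M≡[] = e₁

      Der-mono : ∀ {s s′ χ} → s ⊑ s′ → Der (formulas s) χ → Der (formulas s′) χ
      Der-mono (extends M e) d = subst (λ L → Der L _) (sym e) (Der-weaken M d)

      -- Values are closed terms; a formula is forced at s when it is derivable
      -- from s, so a valuation acts as the substitution `terms`.
      Dom : Ty nB → Set ℓ
      Dom τ = Lift ℓ (Term τ)

      terms : Valuation Dom → FreeSub
      terms u τ k = lower (u τ k)

      canonical : PreModel ℓ
      canonical = record
        { S     = State
        ; _≤_   = _⊑_
        ; ≤-po  = ⊑-po
        ; D     = Dom
        ; D-ne  = λ τ → lift (fvar 0)
        ; _·_   = λ a b → lift (app (lower a) (lower b))
        ; I     = λ c → lift (con c)
        ; ς     = λ d s → Lift ℓ (Der (formulas s) (lower d))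
        ; ς-up  = λ d s⊑s′ x → lift (Der-mono s⊑s′ (lower x))
        ; ⟦_⟧   = λ t u → lift (subFree (terms u) t)
        ; ⟦var⟧ = λ {τ} i u → cong lift (ren-closed (lower (u τ i)))
        ; ⟦con⟧ = λ c u → refl
        ; ⟦app⟧ = λ t s u → refl
        }

      open PreModel canonical using (_,_⊩_; _[_,_↦_])

      -- ⊃: if φ is consistent with s, extend s by φ; otherwise φ ∷ s proves everything.
      imp-clause : ∀ s u φ ψ → (s , u ⊩ imp φ ψ) ⇔ (∀ s′ → s ⊑ s′ → s′ , u ⊩ φ → s′ , u ⊩ ψ)
      imp-clause s u φ ψ = mk⇔ (λ x s′ s⊑s′ y → lift (Der-mp (Der-mono s⊑s′ (lower x)) (lower y))) backward
        where
        φ′ = subFree (terms u) φ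
        ψ′ = subFree (terms u) ψ
        backward : (∀ s′ → s ⊑ s′ → s′ , u ⊩ φ → s′ , u ⊩ ψ) → s , u ⊩ imp φ ψ
        backward h with em {Der (φ′ ∷ formulas s) ⊥f}
        ... | yes (G , G⊆Δₑ , d) = lift (G , G⊆Δₑ , ⊃I (explode d ψ′))
        ... | no φ′-consistent
          with lower (h ⟨ φ′ ∷ formulas s , φ′-consistent ⟩ (extends (φ′ ∷ []) refl)
                        (lift ([] , [] , ax (Any.here refl))))
        ... | G , G⊆Δₑ , d = lift (G , G⊆Δₑ , ⊃I d)

      -- ∀: forward by ∀E; backward by ∀I at an odd variable x_j, fresh for s and for the
      -- formula, and automatically for the hypotheses from Δₑ.
      all-clause : ∀ s u q i φ → (s , u ⊩ ∀[ q , i ] φ) ⇔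
                   (∀ s′ → s ⊑ s′ → (d : Dom ⌜ q ⌝) → s′ , u [ ⌜ q ⌝ , i ↦ d ] ⊩ φ)
      all-clause s u q i φ = mk⇔ forward backward
        where
        Instances : Set ℓ
        Instances = ∀ s′ → s ⊑ s′ → (d : Dom ⌜ q ⌝) → s′ , u [ ⌜ q ⌝ , i ↦ d ] ⊩ φ

        body = subFree (terms u) (close′ [] q i φ)

        instance-at : ∀ d → inst body (lower d) ≡ subFree (terms (u [ ⌜ q ⌝ , i ↦ d ])) φ
        instance-at d = inst-subFree-close q i (terms u) _ φ (lower d)
                          (cong lower (update-same Dom u ⌜ q ⌝ i d))
                          (λ τ k _ ne → cong lower (update-other Dom u ⌜ q ⌝ i d τ k ne))

        forward : s , u ⊩ ∀[ q , i ] φ → Instances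
        forward x s′ s⊑s′ d with Der-mono s⊑s′ (lower x)
        ... | G , G⊆Δₑ , der =
          lift (G , G⊆Δₑ , subst (formulas s′ ++ G ⊢₀_) (instance-at d) (∀E der (lower d)))

        N = fvBoundL (formulas s) ⊔ fvBound body
        j = suc (N + N)

        N≤j : N ≤ j
        N≤j = ≤-trans (m≤m+n N N) (n≤1+n (N + N))

        renamed : close′ [] q j (subFree (terms (u [ ⌜ q ⌝ , i ↦ lift (fvar j) ])) φ) ≡ body
        renamed = close-subFree-close q i j (terms u) _ φ
                    (cong lower (update-same Dom u ⌜ q ⌝ i (lift (fvar j))))
                    (λ τ k _ ne → cong lower (update-other Dom u ⌜ q ⌝ i (lift (fvar j)) τ k ne))
                    (fresh body (≤-trans (m≤n⊔m (fvBoundL (formulas s)) _) N≤j))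

        backward : Instances → s , u ⊩ ∀[ q , i ] φ
        backward h with lower (h s (extends [] refl) (lift (fvar j)))
        ... | G , G⊆Δₑ , der =
          lift (G , G⊆Δₑ , subst (formulas s ++ G ⊢₀_) (cong (all q) renamed) (∀I q j j∉hyps der))
          where
          j∉hyps : ¬ Any (FreeIn ⌜ q ⌝ j) (formulas s ++ G)
          j∉hyps f with AnyP.++⁻ (formulas s) f
          ... | inj₁ f₁ = freshL (formulas s) (≤-trans (m≤m⊔n _ _) N≤j) f₁
          ... | inj₂ f₂ = odd∉Δₑ N G⊆Δₑ f₂

      bot-clause : ∀ s u p → ¬ (s , u ⊩ ∀[ qo , p ] fvar p)
      bot-clause ⟨ L , consistent ⟩ u p (lift d) = ⊥-elim-irr (consistent (subst (Der L) falsum d))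
        where
        falsum : all qo (subFree (terms u) (close′ [] qo p (fvar p))) ≡ ⊥f
        falsum = cong (λ b → all qo (subFree (terms u) b))
                      (trans (close≡sub [] qo p (fvar p)) (closeVar-same [] qo p))

      canonical-isKripke : IsKripke canonical
      canonical-isKripke = record { ⊩imp = imp-clause ; ⊩all = all-clause ; ⊩⊥ = bot-clause }

  -- If Δ ⊩ φ, the canonical model at the empty state and the valuation x_k ↦ x_{2k}
  -- yields a derivation of the even copy of φ from Δₑ (unless Δₑ is inconsistent,
  -- when this holds anyway); renaming back gives Δ ⊢ φ.
  completeness : ∀ ℓ (Δ : Formula → Set) φ → Δ ⊩⟨ ℓ ⟩ φ → Δ ⊢ φ
  completeness ℓ Δ φ valid = from-even derivable
    where
    open Canonical Δ

    derivable : Der [] (subFree toEven φ)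
    derivable with em {Der [] ⊥f}
    ... | yes (G , G⊆Δₑ , d) = G , G⊆Δₑ , explode d (subFree toEven φ)
    ... | no Δₑ-consistent = lower (valid (canonical ℓ) (canonical-isKripke ℓ) ⟨ [] , Δₑ-consistent ⟩
            (λ τ k → lift (fvar (k + k)))
            (λ ψ Δψ → lift (subFree toEven ψ ∷ [] , (ψ , Δψ , refl) ∷ [] , ax (Any.here refl))))

    from-even : Der [] (subFree toEven φ) → Δ ⊢ φ
    from-even (G , G⊆Δₑ , d) =
      map (subFree fromEven) G ,
      AllP.map⁺ (All.map (λ { (ψ , Δψ , refl) → subst Δ (sym (fromEven-toEven ψ)) Δψ }) G⊆Δₑ) ,
      subst (map (subFree fromEven) G ⊢₀_) (fromEven-toEven φ) (⊢₀-subst fromEven d (∈-map⁺ (subFree fromEven)))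


-- Theorem 5: semantic consequence and derivability coincide.
mainTheorem5 : (nB : ℕ) (Con : Ty nB → Set) →
    ((τ : Ty nB) → Con τ ↣ ℕ) →
    ({a : Level} → ExcludedMiddle a) →
    (ℓ : Level) →
    let open PRED2 nB Con in
    (Δ : Formula → Set) (φ : Formula) →
    (Δ ⊩⟨ ℓ ⟩ φ) ⇔ (Δ ⊢ φ)
mainTheorem5 nB Con _ em ℓ Δ φ =
  mk⇔ (Completeness.completeness nB Con em ℓ Δ φ) (Soundness.soundness nB Con ℓ Δ φ)
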